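{- Let $\mathbf{B}$ be a topological Boolean algebra, $\nabla$ an open filter of $\mathbf{B}$, $\Delta$ a closed ideal of $\mathbf{B}$, and $\mathbf{T}=Tw(\mathbf{B},\nabla,\Delta)$. Then: (1) $a\wedge\Box\neg a=\bot$ for all $a\in B$; hence $a\wedge\Box\neg a\in\Delta$; (2) $\Gamma(\mathbf{T})\subseteq \mathsf{G}(\mathbf{B})$; (3) $\mathsf{G}_2(\mathbf{T})$ is closed under the operations $\vee,\wedge,\sim$ of $\mathcal{G}(\mathbf{B})^{\bowtie}$, and $\bot_{\mathcal{G}(\mathbf{B})^{\bowtie}}=(\bot,1)\in\mathsf{G}_2(\mathbf{T})$; (4) $\pi_2(\mathsf{G}_2(\mathbf{T}))=\Gamma(\mathbf{T})$; (5) $\Gamma(\mathbf{T})$ is closed under $\vee$ and $\wedge$ of $\mathcal{G}(\mathbf{B})$ and $\bot\in\Gamma(\mathbf{T})$; (6) $\Lambda(\mathbf{B},\nabla)\subseteq\Gamma(\mathbf{T})$; (7) $\Lambda(\mathbf{B},\nabla)$ is (the universe of) a subalgebra of $\mathcal{G}(\mathbf{B})$, i.e. it contains $\bot$ and is closed under $\vee$, $\wedge$ and $a\to_{\mathcal{G}(\mathbf{B})}b=\Box(a\to b)$.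
   Context: A topological Boolean algebra (TBA) is an algebra $\mathbf{B}=\langle B;\vee,\wedge,\to,\bot,\Box\rangle$ whose reduct $\langle B;\vee,\wedge,\to,\bot\rangle$ is a Boolean algebra (top $1$, $\neg a:=a\to\bot$) and $\Box 1=1$, $\Box(a\wedge b)=\Box a\wedge\Box b$, $\Box a\le a$, $\Box a\le\Box\Box a$; put $\Diamond a:=\neg\Box\neg a$. $\mathsf{G}(\mathbf{B})=\{a\in B:\Box a=a\}$ (open elements); the algebra of open elements is the Heyting algebra $\mathcal{G}(\mathbf{B})=\langle \mathsf{G}(\mathbf{B});\vee,\wedge,\to_{\mathcal{G}(\mathbf{B})},\bot\rangle$ with $a\to_{\mathcal{G}(\mathbf{B})}b:=\Box(a\to b)$. A filter is open if closed under $\Box$; an ideal is closed if closed under $\Diamond$. For a Heyting algebra $\mathbf{C}$, the full twist-structure $\mathbf{C}^{\bowtie}$ has universe $C\times C$ and operations $(a,b)\vee(c,d)=(a\vee c,b\wedge d)$, $(a,b)\wedge(c,d)=(a\wedge c,b\vee d)$, $(a,b)\to(c,d)=(a\to c,a\wedge d)$, $\bot=(\bot,1)$, $\sim(a,b)=(b,a)$; for a TBA one adds $\Box(a,b)=(\Box a,\Diamond b)$, $\Diamond(a,b)=(\Diamond a,\Box b)$. $\pi_1,\pi_2$ are the projections. For a TBA $\mathbf{B}$, open filter $\nabla$ and closed ideal $\Delta$, $Tw(\mathbf{B},\nabla,\Delta)$ is the subalgebra of $\mathbf{B}^{\bowtie}$ with universe $\{(a,b)\in B\times B: a\vee b\in\nabla,\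 a\wedge b\in\Delta\}$. For $\mathbf{T}=Tw(\mathbf{B},\nabla,\Delta)$: $\mathsf{G}_2(\mathbf{T})=\{(a,b)\in\mathbf{T}:\Box a=a,\ \Box b=b\}$, $\Gamma(\mathbf{T})=\pi_1(\mathsf{G}_2(\mathbf{T}))$, and $\Lambda(\mathbf{B},\nabla)=\{a\in\mathsf{G}(\mathbf{B}): a\vee\Box\neg a\in\nabla\}$. -}

module Defs where

open import Level using (Level; _⊔_; suc)
open import Algebra.Lattice.Bundles using (BooleanAlgebra)
open import Data.Product using (Σ; _×_; _,_; ∃; proj₁; proj₂)
open import Function.Bundles using (_⇔_)
open import Relation.Unary using (Pred; _∈_; _⊆_)

record TBA (c ℓ : Level) : Set (suc (c ⊔ ℓ)) where
  field
    booleanAlgebra : BooleanAlgebra c ℓ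
  open BooleanAlgebra booleanAlgebra public
  _≤_ : Carrier → Carrier → Set ℓ
  a ≤ b = (a ∧ b) ≈ a
  _⇒_ : Carrier → Carrier → Carrier
  a ⇒ b = (¬ a) ∨ b
  field
    □ : Carrier → Carrier
    □-cong : ∀ {a b} → a ≈ b → □ a ≈ □ b
    □-⊤ : □ ⊤ ≈ ⊤
    □-∧ : ∀ a b → □ (a ∧ b) ≈ (□ a ∧ □ b)
    □-deflationary : ∀ a → □ a ≤ a
    □-4 : ∀ a → □ a ≤ □ (□ a)
  ◇ : Carrier → Carrier
  ◇ a = ¬ (□ (¬ a))

module _ {c ℓ : Level} (B : TBA c ℓ) where
  open TBA B

  IsOpen : Carrier → Set ℓ
  IsOpen a = □ a ≈ a

  record IsOpenFilter {p : Level} (F : Pred Carrier p) : Set (c ⊔ ℓ ⊔ p) where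
    field
      ⊤∈ : ⊤ ∈ F
      up : ∀ {a b} → a ≤ b → a ∈ F → b ∈ F
      ∧-closed : ∀ {a b} → a ∈ F → b ∈ F → (a ∧ b) ∈ F
      □-closed : ∀ {a} → a ∈ F → □ a ∈ F

  record IsClosedIdeal {p : Level} (I : Pred Carrier p) : Set (c ⊔ ℓ ⊔ p) where
    field
      ⊥∈ : ⊥ ∈ I
      down : ∀ {a b} → a ≤ b → b ∈ I → a ∈ I
      ∨-closed : ∀ {a b} → a ∈ I → b ∈ I → (a ∨ b) ∈ I
      ◇-closed : ∀ {a} → a ∈ I → ◇ a ∈ I

  module _ {p q : Level} (∇ : Pred Carrier p) (Δ : Pred Carrier q) where
    Tw : Pred (Carrier × Carrier) (p ⊔ q)
    Tw (a , b) = ((a ∨ b) ∈ ∇) × ((a ∧ b) ∈ Δ)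

    G₂ : Pred (Carrier × Carrier) (ℓ ⊔ p ⊔ q)
    G₂ (a , b) = ((a , b) ∈ Tw) × (IsOpen a × IsOpen b)

    Γ : Pred Carrier (c ⊔ ℓ ⊔ p ⊔ q)
    Γ a = ∃ λ b → (a , b) ∈ G₂

    π₂G₂ : Pred Carrier (c ⊔ ℓ ⊔ p ⊔ q)
    π₂G₂ b = ∃ λ a → (a , b) ∈ G₂

  Λ : {p : Level} → Pred Carrier p → Pred Carrier (ℓ ⊔ p)
  Λ ∇ a = IsOpen a × ((a ∨ □ (¬ a)) ∈ ∇)

-- Everything reduces to order reasoning in B. Tw(B, ∇, Δ) is closed under the twist
-- operations ∨, ∧, ∼ because ∇ is an upward-closed ∧-closed set and Δ a downward-closed
-- ∨-closed set; intersecting with open pairs then gives G₂(T), whose two projections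
-- coincide since ∼ swaps them. For a ∈ Λ the pair (a, □ ¬ a) lies in G₂(T) because
-- a ∧ □ ¬ a = ⊥. Closure of Λ under the Heyting operations of G(B) comes from
-- distributing (a ∨ □ ¬ a) ∧ (b ∨ □ ¬ b); for the implication the key point is that
-- a ∧ □ ¬ b is open and lies below ¬ □ (a ⇒ b) when a is open.
module Submission where

open import Defs
open import Level using (Level)
open import Data.Product using (_×_; _,_)
open import Relation.Unary using (Pred; _∈_; _⊆_)
open import Algebra.Lattice.Bundles using (BooleanAlgebra)
import Algebra.Lattice.Properties.Lattice as LatticeProperties
import Algebra.Lattice.Properties.BooleanAlgebra as BooleanAlgebraProperties
import Relation.Binary.Lattice as OrderTheoretic
import Relation.Binary.Lattice.Properties.MeetSemilattice as MeetSemilatticeProperties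
import Relation.Binary.Lattice.Properties.JoinSemilattice as JoinSemilatticeProperties
import Relation.Binary.Reasoning.PartialOrder as PosetReasoning

module BooleanAlgebraOrder {c ℓ : Level} (B : BooleanAlgebra c ℓ) where
  open BooleanAlgebra B
  open BooleanAlgebraProperties B using (∧-zeroˡ; deMorgan₁; deMorgan₂; ¬-involutive)

  private
    orderLattice : OrderTheoretic.Lattice c ℓ ℓ
    orderLattice = LatticeProperties.∨-∧-orderTheoreticLattice lattice

  open OrderTheoretic.Lattice orderLattice public
    using (_≤_; poset; antisym; x≤x∨y; y≤x∨y; ∨-least; x∧y≤x; x∧y≤y)
    renaming (refl to ≤-refl; reflexive to ≤-reflexive; trans to ≤-trans)
  open MeetSemilatticeProperties (OrderTheoretic.Lattice.meetSemilattice orderLattice) public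
    using (∧-monotonic)
  open JoinSemilatticeProperties (OrderTheoretic.Lattice.joinSemilattice orderLattice) public
    using (∨-monotonic)
  open PosetReasoning poset

  ⊥-minimum : ∀ x → ⊥ ≤ x
  ⊥-minimum x = sym (∧-zeroˡ x)

  ¬-antitone : ∀ {x y} → x ≤ y → ¬ y ≤ ¬ x
  ¬-antitone {x} {y} x≈x∧y = begin
    ¬ y          ≤⟨ y≤x∨y (¬ x) (¬ y) ⟩
    ¬ x ∨ ¬ y    ≈⟨ deMorgan₁ x y ⟨
    ¬ (x ∧ y)    ≈⟨ ¬-cong x≈x∧y ⟨
    ¬ x          ∎

  ¬[¬x∨y]≈x∧¬y : ∀ x y → ¬ (¬ x ∨ y) ≈ x ∧ ¬ y
  ¬[¬x∨y]≈x∧¬y x y = trans (deMorgan₂ (¬ x) y) (∧-congʳ (¬-involutive x))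

  [x∨y]∧[z∨w]≤[x∨z]∨[y∧w] : ∀ x y z w → (x ∨ y) ∧ (z ∨ w) ≤ (x ∨ z) ∨ (y ∧ w)
  [x∨y]∧[z∨w]≤[x∨z]∨[y∧w] x y z w = begin
    (x ∨ y) ∧ (z ∨ w)                  ≈⟨ ∧-distribʳ-∨ (z ∨ w) x y ⟩
    x ∧ (z ∨ w) ∨ y ∧ (z ∨ w)          ≈⟨ ∨-congˡ (∧-distribˡ-∨ y z w) ⟩
    x ∧ (z ∨ w) ∨ (y ∧ z ∨ y ∧ w)      ≤⟨ ∨-monotonic (x∧y≤x x _) (∨-monotonic (x∧y≤y y z) ≤-refl) ⟩
    x ∨ (z ∨ y ∧ w)                    ≈⟨ ∨-assoc x z (y ∧ w) ⟨
    (x ∨ z) ∨ y ∧ w                    ∎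

  [x∨y]∧[z∨w]≤[x∧z]∨[y∨w] : ∀ x y z w → (x ∨ y) ∧ (z ∨ w) ≤ (x ∧ z) ∨ (y ∨ w)
  [x∨y]∧[z∨w]≤[x∧z]∨[y∨w] x y z w = begin
    (x ∨ y) ∧ (z ∨ w)                  ≈⟨ ∧-distribʳ-∨ (z ∨ w) x y ⟩
    x ∧ (z ∨ w) ∨ y ∧ (z ∨ w)          ≈⟨ ∨-congʳ (∧-distribˡ-∨ x z w) ⟩
    (x ∧ z ∨ x ∧ w) ∨ y ∧ (z ∨ w)      ≤⟨ ∨-monotonic (∨-monotonic ≤-refl (x∧y≤y x w)) (x∧y≤x y _) ⟩
    (x ∧ z ∨ w) ∨ y                    ≈⟨ ∨-assoc (x ∧ z) w y ⟩
    x ∧ z ∨ (w ∨ y)                    ≈⟨ ∨-congˡ (∨-comm w y) ⟩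
    x ∧ z ∨ (y ∨ w)                    ∎

  [x∨y]∧[z∧w]≤[x∧z]∨[y∧w] : ∀ x y z w → (x ∨ y) ∧ (z ∧ w) ≤ (x ∧ z) ∨ (y ∧ w)
  [x∨y]∧[z∧w]≤[x∧z]∨[y∧w] x y z w = begin
    (x ∨ y) ∧ (z ∧ w)                  ≈⟨ ∧-distribʳ-∨ (z ∧ w) x y ⟩
    x ∧ (z ∧ w) ∨ y ∧ (z ∧ w)          ≤⟨ ∨-monotonic (∧-monotonic ≤-refl (x∧y≤x z w))
                                                      (∧-monotonic ≤-refl (x∧y≤y z w)) ⟩
    x ∧ z ∨ y ∧ w                      ∎

module InteriorOperator {c ℓ : Level} (B : TBA c ℓ) where
  open TBA B hiding (_≤_)
  open BooleanAlgebraOrder booleanAlgebra public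
  open BooleanAlgebraProperties booleanAlgebra using (¬⊥≈⊤)
  open PosetReasoning poset

  -- The order of TBA reads a ∧ b ≈ a and the order-theoretic one a ≈ a ∧ b, so sym converts.
  □x≤x : ∀ x → □ x ≤ x
  □x≤x x = sym (□-deflationary x)

  □-monotonic : ∀ {x y} → x ≤ y → □ x ≤ □ y
  □-monotonic {x} {y} x≈x∧y = trans (□-cong x≈x∧y) (□-∧ x y)

  □-idempotent : ∀ x → IsOpen B (□ x)
  □-idempotent x = antisym (□x≤x (□ x)) (sym (□-4 x))

  □-⊥ : IsOpen B ⊥
  □-⊥ = antisym (□x≤x ⊥) (⊥-minimum (□ ⊥))

  □¬⊥≈⊤ : □ (¬ ⊥) ≈ ⊤
  □¬⊥≈⊤ = trans (□-cong ¬⊥≈⊤) □-⊤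

  □x∨□y≤□[x∨y] : ∀ x y → □ x ∨ □ y ≤ □ (x ∨ y)
  □x∨□y≤□[x∨y] x y = ∨-least (□-monotonic (x≤x∨y x y)) (□-monotonic (y≤x∨y x y))

  IsOpen-∨ : ∀ {x y} → IsOpen B x → IsOpen B y → IsOpen B (x ∨ y)
  IsOpen-∨ {x} {y} □x≈x □y≈y = antisym (□x≤x (x ∨ y)) (begin
    x ∨ y        ≈⟨ ∨-cong □x≈x □y≈y ⟨
    □ x ∨ □ y    ≤⟨ □x∨□y≤□[x∨y] x y ⟩
    □ (x ∨ y)    ∎)

  IsOpen-∧ : ∀ {x y} → IsOpen B x → IsOpen B y → IsOpen B (x ∧ y)
  IsOpen-∧ {x} {y} □x≈x □y≈y = trans (□-∧ x y) (∧-cong □x≈x □y≈y)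

  x∧□¬x≈⊥ : ∀ x → x ∧ □ (¬ x) ≈ ⊥
  x∧□¬x≈⊥ x = antisym (begin
    x ∧ □ (¬ x)  ≤⟨ ∧-monotonic ≤-refl (□x≤x (¬ x)) ⟩
    x ∧ ¬ x      ≈⟨ ∧-complementʳ x ⟩
    ⊥            ∎) (⊥-minimum _)

  x∧□¬y≤□¬□[x⇒y] : ∀ {x} y → IsOpen B x → x ∧ □ (¬ y) ≤ □ (¬ (□ (x ⇒ y)))
  x∧□¬y≤□¬□[x⇒y] {x} y □x≈x = begin
    x ∧ □ (¬ y)              ≈⟨ IsOpen-∧ □x≈x (□-idempotent (¬ y)) ⟨
    □ (x ∧ □ (¬ y))          ≤⟨ □-monotonic (∧-monotonic ≤-refl (□x≤x (¬ y))) ⟩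
    □ (x ∧ ¬ y)              ≈⟨ □-cong (¬[¬x∨y]≈x∧¬y x y) ⟨
    □ (¬ (x ⇒ y))            ≤⟨ □-monotonic (¬-antitone (□x≤x (x ⇒ y))) ⟩
    □ (¬ (□ (x ⇒ y)))        ∎

module ΛSubalgebra {c ℓ p : Level} (B : TBA c ℓ) {∇ : Pred (TBA.Carrier B) p}
               (∇-filter : IsOpenFilter B ∇) where
  open TBA B hiding (_≤_)
  open InteriorOperator B
  open BooleanAlgebraProperties booleanAlgebra using (deMorgan₁; deMorgan₂)
  open IsOpenFilter ∇-filter using (⊤∈; ∧-closed) renaming (up to up′)
  open PosetReasoning poset

  ∇-upward : ∀ {x y} → x ≤ y → x ∈ ∇ → y ∈ ∇
  ∇-upward x≤y = up′ (sym x≤y)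

  Λ-⊥ : ⊥ ∈ Λ B ∇
  Λ-⊥ = □-⊥ , ∇-upward (≤-trans (≤-reflexive (sym □¬⊥≈⊤)) (y≤x∨y ⊥ _)) ⊤∈

  Λ-∨ : ∀ {x y} → x ∈ Λ B ∇ → y ∈ Λ B ∇ → (x ∨ y) ∈ Λ B ∇
  Λ-∨ {x} {y} (□x≈x , x∈∇) (□y≈y , y∈∇) = IsOpen-∨ □x≈x □y≈y , ∇-upward (begin
    (x ∨ □ (¬ x)) ∧ (y ∨ □ (¬ y))     ≤⟨ [x∨y]∧[z∨w]≤[x∨z]∨[y∧w] x _ y _ ⟩
    (x ∨ y) ∨ □ (¬ x) ∧ □ (¬ y)       ≈⟨ ∨-congˡ (□-∧ (¬ x) (¬ y)) ⟨
    (x ∨ y) ∨ □ (¬ x ∧ ¬ y)           ≈⟨ ∨-congˡ (□-cong (deMorgan₂ x y)) ⟨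
    (x ∨ y) ∨ □ (¬ (x ∨ y))           ∎) (∧-closed x∈∇ y∈∇)

  Λ-∧ : ∀ {x y} → x ∈ Λ B ∇ → y ∈ Λ B ∇ → (x ∧ y) ∈ Λ B ∇
  Λ-∧ {x} {y} (□x≈x , x∈∇) (□y≈y , y∈∇) = IsOpen-∧ □x≈x □y≈y , ∇-upward (begin
    (x ∨ □ (¬ x)) ∧ (y ∨ □ (¬ y))     ≤⟨ [x∨y]∧[z∨w]≤[x∧z]∨[y∨w] x _ y _ ⟩
    (x ∧ y) ∨ (□ (¬ x) ∨ □ (¬ y))     ≤⟨ ∨-monotonic ≤-refl (□x∨□y≤□[x∨y] (¬ x) (¬ y)) ⟩
    (x ∧ y) ∨ □ (¬ x ∨ ¬ y)           ≈⟨ ∨-congˡ (□-cong (deMorgan₁ x y)) ⟨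
    (x ∧ y) ∨ □ (¬ (x ∧ y))           ∎) (∧-closed x∈∇ y∈∇)

  Λ-⇒ : ∀ {x y} → x ∈ Λ B ∇ → y ∈ Λ B ∇ → □ (x ⇒ y) ∈ Λ B ∇
  Λ-⇒ {x} {y} (□x≈x , x∈∇) (□y≈y , y∈∇) = □-idempotent (x ⇒ y) , ∇-upward (begin
    (x ∨ □ (¬ x)) ∧ (y ∨ □ (¬ y))     ≈⟨ ∧-congʳ (∨-comm x (□ (¬ x))) ⟩
    (□ (¬ x) ∨ x) ∧ (y ∨ □ (¬ y))     ≤⟨ [x∨y]∧[z∨w]≤[x∨z]∨[y∧w] (□ (¬ x)) x y _ ⟩
    (□ (¬ x) ∨ y) ∨ x ∧ □ (¬ y)       ≈⟨ ∨-congʳ (∨-congˡ □y≈y) ⟨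
    (□ (¬ x) ∨ □ y) ∨ x ∧ □ (¬ y)     ≤⟨ ∨-monotonic (□x∨□y≤□[x∨y] (¬ x) y) (x∧□¬y≤□¬□[x⇒y] y □x≈x) ⟩
    □ (x ⇒ y) ∨ □ (¬ (□ (x ⇒ y)))     ∎) (∧-closed x∈∇ y∈∇)

module TwistStructure {c ℓ p q : Level} (B : TBA c ℓ)
                      {∇ : Pred (TBA.Carrier B) p} {Δ : Pred (TBA.Carrier B) q}
                      (∇-filter : IsOpenFilter B ∇) (Δ-ideal : IsClosedIdeal B Δ) where
  open TBA B hiding (_≤_)
  open InteriorOperator B
  open ΛSubalgebra B ∇-filter public
  open IsOpenFilter ∇-filter using (⊤∈; ∧-closed)
  open IsClosedIdeal Δ-ideal using (⊥∈; ∨-closed; down)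

  Δ-downward : ∀ {x y} → x ≤ y → y ∈ Δ → x ∈ Δ
  Δ-downward x≤y = down (sym x≤y)

  x∧□¬x∈Δ : ∀ x → x ∧ □ (¬ x) ∈ Δ
  x∧□¬x∈Δ x = Δ-downward (≤-reflexive (x∧□¬x≈⊥ x)) ⊥∈

  Tw-∨ : ∀ {a b c′ d} → (a , b) ∈ Tw B ∇ Δ → (c′ , d) ∈ Tw B ∇ Δ → (a ∨ c′ , b ∧ d) ∈ Tw B ∇ Δ
  Tw-∨ {a} {b} {c′} {d} (a∨b∈∇ , a∧b∈Δ) (c′∨d∈∇ , c′∧d∈Δ) =
    ∇-upward ([x∨y]∧[z∨w]≤[x∨z]∨[y∧w] a b c′ d) (∧-closed a∨b∈∇ c′∨d∈∇) ,
    Δ-downward ([x∨y]∧[z∧w]≤[x∧z]∨[y∧w] a c′ b d) (∨-closed a∧b∈Δ c′∧d∈Δ)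

  Tw-∼ : ∀ {a b} → (a , b) ∈ Tw B ∇ Δ → (b , a) ∈ Tw B ∇ Δ
  Tw-∼ {a} {b} (a∨b∈∇ , a∧b∈Δ) =
    ∇-upward (≤-reflexive (∨-comm a b)) a∨b∈∇ , Δ-downward (≤-reflexive (∧-comm b a)) a∧b∈Δ

  -- (a , b) ∧ (c′ , d) is ∼ (∼ (a , b) ∨ ∼ (c′ , d)) on the nose.
  Tw-∧ : ∀ {a b c′ d} → (a , b) ∈ Tw B ∇ Δ → (c′ , d) ∈ Tw B ∇ Δ → (a ∧ c′ , b ∨ d) ∈ Tw B ∇ Δ
  Tw-∧ ab∈Tw cd∈Tw = Tw-∼ (Tw-∨ (Tw-∼ ab∈Tw) (Tw-∼ cd∈Tw))

  G₂-∨ : ∀ {a b c′ d} → (a , b) ∈ G₂ B ∇ Δ → (c′ , d) ∈ G₂ B ∇ Δ → (a ∨ c′ , b ∧ d) ∈ G₂ B ∇ Δ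
  G₂-∨ (ab∈Tw , □a≈a , □b≈b) (cd∈Tw , □c≈c , □d≈d) =
    Tw-∨ ab∈Tw cd∈Tw , IsOpen-∨ □a≈a □c≈c , IsOpen-∧ □b≈b □d≈d

  G₂-∧ : ∀ {a b c′ d} → (a , b) ∈ G₂ B ∇ Δ → (c′ , d) ∈ G₂ B ∇ Δ → (a ∧ c′ , b ∨ d) ∈ G₂ B ∇ Δ
  G₂-∧ (ab∈Tw , □a≈a , □b≈b) (cd∈Tw , □c≈c , □d≈d) =
    Tw-∧ ab∈Tw cd∈Tw , IsOpen-∧ □a≈a □c≈c , IsOpen-∨ □b≈b □d≈d

  G₂-∼ : ∀ {a b} → (a , b) ∈ G₂ B ∇ Δ → (b , a) ∈ G₂ B ∇ Δ
  G₂-∼ (ab∈Tw , □a≈a , □b≈b) = Tw-∼ ab∈Tw , □b≈b , □a≈a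

  G₂-⊥ : (⊥ , ⊤) ∈ G₂ B ∇ Δ
  G₂-⊥ = (∇-upward (y≤x∨y ⊥ ⊤) ⊤∈ , Δ-downward (x∧y≤x ⊥ ⊤) ⊥∈) , □-⊥ , □-⊤

  Γ⊆IsOpen : Γ B ∇ Δ ⊆ IsOpen B
  Γ⊆IsOpen (_ , _ , □a≈a , _) = □a≈a

  π₂G₂⊆Γ : π₂G₂ B ∇ Δ ⊆ Γ B ∇ Δ
  π₂G₂⊆Γ (a , ab∈G₂) = a , G₂-∼ ab∈G₂

  Γ⊆π₂G₂ : Γ B ∇ Δ ⊆ π₂G₂ B ∇ Δ
  Γ⊆π₂G₂ (b , ab∈G₂) = b , G₂-∼ ab∈G₂

  Γ-∨ : ∀ {a c′} → a ∈ Γ B ∇ Δ → c′ ∈ Γ B ∇ Δ → (a ∨ c′) ∈ Γ B ∇ Δ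
  Γ-∨ (_ , ab∈G₂) (_ , cd∈G₂) = _ , G₂-∨ ab∈G₂ cd∈G₂

  Γ-∧ : ∀ {a c′} → a ∈ Γ B ∇ Δ → c′ ∈ Γ B ∇ Δ → (a ∧ c′) ∈ Γ B ∇ Δ
  Γ-∧ (_ , ab∈G₂) (_ , cd∈G₂) = _ , G₂-∧ ab∈G₂ cd∈G₂

  Γ-⊥ : ⊥ ∈ Γ B ∇ Δ
  Γ-⊥ = ⊤ , G₂-⊥

  Λ⊆Γ : Λ B ∇ ⊆ Γ B ∇ Δ
  Λ⊆Γ {a} (□a≈a , a∨□¬a∈∇) = □ (¬ a) , (a∨□¬a∈∇ , x∧□¬x∈Δ a) , □a≈a , □-idempotent (¬ a)

lemma3p1p1 : {c ℓ p q : Level} (B : TBA c ℓ) →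
    let open TBA B in
    (∇ : Carrier → Set p) (Δ : Carrier → Set q) →
    IsOpenFilter B ∇ → IsClosedIdeal B Δ →
    ((∀ a → (a ∧ □ (¬ a)) ≈ ⊥) × (∀ a → (a ∧ □ (¬ a)) ∈ Δ))
    × (Γ B ∇ Δ ⊆ IsOpen B)
    × ((∀ {a b c′ d} → (a , b) ∈ G₂ B ∇ Δ → (c′ , d) ∈ G₂ B ∇ Δ →
          (a ∨ c′ , b ∧ d) ∈ G₂ B ∇ Δ)
       × (∀ {a b c′ d} → (a , b) ∈ G₂ B ∇ Δ → (c′ , d) ∈ G₂ B ∇ Δ →
          (a ∧ c′ , b ∨ d) ∈ G₂ B ∇ Δ)
       × (∀ {a b} → (a , b) ∈ G₂ B ∇ Δ → (b , a) ∈ G₂ B ∇ Δ)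
       × ((⊥ , ⊤) ∈ G₂ B ∇ Δ))
    × ((π₂G₂ B ∇ Δ ⊆ Γ B ∇ Δ) × (Γ B ∇ Δ ⊆ π₂G₂ B ∇ Δ))
    × ((∀ {a b} → a ∈ Γ B ∇ Δ → b ∈ Γ B ∇ Δ → (a ∨ b) ∈ Γ B ∇ Δ)
       × (∀ {a b} → a ∈ Γ B ∇ Δ → b ∈ Γ B ∇ Δ → (a ∧ b) ∈ Γ B ∇ Δ)
       × (⊥ ∈ Γ B ∇ Δ))
    × (Λ B ∇ ⊆ Γ B ∇ Δ)
    × ((⊥ ∈ Λ B ∇)
       × (∀ {a b} → a ∈ Λ B ∇ → b ∈ Λ B ∇ → (a ∨ b) ∈ Λ B ∇)
       × (∀ {a b} → a ∈ Λ B ∇ → b ∈ Λ B ∇ → (a ∧ b) ∈ Λ B ∇)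
       × (∀ {a b} → a ∈ Λ B ∇ → b ∈ Λ B ∇ → □ (a ⇒ b) ∈ Λ B ∇))
lemma3p1p1 B ∇ Δ ∇-filter Δ-ideal =
  (x∧□¬x≈⊥ , x∧□¬x∈Δ) ,
  Γ⊆IsOpen ,
  (G₂-∨ , G₂-∧ , G₂-∼ , G₂-⊥) ,
  (π₂G₂⊆Γ , Γ⊆π₂G₂) ,
  (Γ-∨ , Γ-∧ , Γ-⊥) ,
  Λ⊆Γ ,
  (Λ-⊥ , Λ-∨ , Λ-∧ , Λ-⇒)
  where
  open InteriorOperator B using (x∧□¬x≈⊥)
  open TwistStructure B ∇-filter Δ-ideal
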